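{- Let $A_1=(\mathcal{S}_1,\mathcal{E},\mathcal{I}_1,\mathcal{F}_1,\to_1)$ and $A_2=(\mathcal{S}_2,\mathcal{E},\mathcal{I}_2,\mathcal{F}_2,\to_2)$ be Büchi automata over the same set of events. For $X\subseteq\mathcal{S}_1\times\mathcal{S}_2$ define $$\texttt{fsim}^\texttt{W}_\texttt{rdelay}(X)\triangleq\mu Y.\ \{(s_1,s_2)\mid\forall e.\forall s_1\xrightarrow{e}_1 s_1'.\exists s_2\xrightarrow{e}_2 s_2'.\ (s_1',s_2')\in Y\}\ \cup\ X,$$ $$\texttt{fsim}^\texttt{R}_\texttt{rdelay}(X)\triangleq\mu Y.\ \{(s_1,s_2)\mid s_2\in\mathcal{F}_2\wedge\forall e.\forall s_1\xrightarrow{e}_1 s_1'.\exists s_2\xrightarrow{e}_2 s_2'.\ (s_1',s_2')\in\texttt{fsim}^\texttt{W}_\texttt{rdelay}(X)\}\ \cup\ \{(s_1,s_2)\mid \forall e.\forall s_1\xrightarrow{e}_1 s_1'.\exists s_2\xrightarrow{e}_2 s_2'.\ (s_1',s_2')\in Y\},$$ $$\texttt{fsim}^\texttt{L}_\texttt{rdelay}\triangleq\nu X.\ \texttt{fsim}^\texttt{R}_\texttt{rdelay}(X)\ \cup\ \{(s_1,s_2)\mid s_1\notin\mathcal{F}_1\wedge\forall e.\forall s_1\xrightarrow{e}_1 s_1'.\exists s_2\xrightarrow{e}_2 s_2'.\ (s_1',s_2')\in X\},$$ and the repeated delay simulation $\texttt{fsim}_\texttt{rdelay}\triangleq\texttt{fsim}^\texttt{W}_\texttt{rdelay}(\texttt{fsim}^\texttt{L}_\texttt{rdelay})$.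 Then for all $(s_1,s_2)\in\texttt{fsim}_\texttt{rdelay}$, $\mathcal{L}_{A_1}(s_1)\subseteq\mathcal{L}_{A_2}(s_2)$.
   Context: A Büchi automaton $(\mathcal{S},\mathcal{E},\mathcal{I},\mathcal{F},\to)$ consists of a set of states $\mathcal{S}$ (not necessarily finite), a set of events $\mathcal{E}$, initial states $\mathcal{I}\subseteq\mathcal{S}$, accepting states $\mathcal{F}\subseteq\mathcal{S}$, and a labeled transition relation $\to\subseteq\mathcal{S}\times\mathcal{E}\times\mathcal{S}$ (written $s\xrightarrow{e}s'$). $\nu$ and $\mu$ denote greatest and least fixed points of monotone operators on powerset lattices (all operators above are monotone in $X$ and $Y$). The language of automaton $A$ is $\mathcal{L}_A\triangleq\nu L.\ \mu X.\ \{(s,e\cdot\tau)\mid \exists s\xrightarrow{e}s'.\ (s',\tau)\in X\}\cup\{(s,e\cdot\tau)\mid s\in\mathcal{F}\wedge \exists s\xrightarrow{e}s'.\ (s',\tau)\in L\}\subseteq\mathcal{S}\times\mathcal{E}^\omega$, and $\mathcal{L}_A(s)\triangleq\{\tau\mid (s,\tau)\in\mathcal{L}_A\}$. -}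

module Defs where

open import Level using (Level; _⊔_) renaming (suc to lsuc; zero to 0ℓ)
open import Data.Nat using (ℕ; zero; suc)
open import Data.Product using (Σ; Σ-syntax; ∃; ∃-syntax; _×_; _,_)
open import Data.Sum using (_⊎_)
open import Relation.Nullary using (¬_)
open import Relation.Unary using (Pred; _⊆_; _∈_)

-- ω-words over E: infinite sequences of events, e·τ decomposes as
-- head τ = τ 0 and tail τ = τ ∘ suc.
Word : Set → Set
Word E = ℕ → E

hd : {E : Set} → Word E → E
hd τ = τ zero

tl : {E : Set} → Word E → Word E
tl τ n = τ (suc n)

-- Greatest fixed point of an operator on the powerset lattice Pred A 0ℓ
-- (Knaster–Tarski: the union of all post-fixed points).
ν : {A : Set} → (Pred A 0ℓ → Pred A 0ℓ) → Pred A (lsuc 0ℓ)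
ν {A} F a = Σ[ P ∈ Pred A 0ℓ ] (P ⊆ F P × a ∈ P)

-- Least fixed points are rendered as inductive data types below.

-- A Büchi automaton over the event set E (state set arbitrary, not
-- necessarily finite).  Subsets are rendered as Set-valued predicates.
record Buchi (E : Set) : Set₁ where
  field
    State : Set
    Init  : State → Set
    Acc   : State → Set
    Step  : State → E → State → Set

-- The language  L_A = ν L. μ X. {(s,e·τ) | ∃ s-e->s'. (s',τ)∈X}
--                               ∪ {(s,e·τ) | s∈F ∧ ∃ s-e->s'. (s',τ)∈L}
module _ {E : Set} (A : Buchi E) where
  open Buchi A

  data LangF (L : Pred (State × Word E) 0ℓ) : Pred (State × Word E) 0ℓ where
    next : ∀ {s τ s'} → Step s (hd τ) s' → LangF L (s' , tl τ) → LangF L (s , τ)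
    acc  : ∀ {s τ s'} → Acc s → Step s (hd τ) s' → L (s' , tl τ) → LangF L (s , τ)

  Lang : Pred (State × Word E) (lsuc 0ℓ)
  Lang = ν LangF

  Lang⟨_⟩ : State → Pred (Word E) (lsuc 0ℓ)
  Lang⟨ s ⟩ τ = Lang (s , τ)

module Sim {E : Set} (A₁ A₂ : Buchi E) where
  open Buchi A₁ renaming (State to S₁; Acc to F₁; Step to Step₁; Init to I₁)
  open Buchi A₂ renaming (State to S₂; Acc to F₂; Step to Step₂; Init to I₂)

  Post : ∀ {ℓ} → Pred (S₁ × S₂) ℓ → Pred (S₁ × S₂) ℓ
  Post Y (s₁ , s₂) = ∀ e s₁' → Step₁ s₁ e s₁' → ∃[ s₂' ] (Step₂ s₂ e s₂' × Y (s₁' , s₂'))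

  data FsimW {ℓ} (X : Pred (S₁ × S₂) ℓ) : Pred (S₁ × S₂) ℓ where
    stepW : ∀ {p} → Post (FsimW X) p → FsimW X p
    baseW : ∀ {p} → X p → FsimW X p

  data FsimR (X : Pred (S₁ × S₂) 0ℓ) : Pred (S₁ × S₂) 0ℓ where
    accR  : ∀ {s₁ s₂} → F₂ s₂ → Post (FsimW X) (s₁ , s₂) → FsimR X (s₁ , s₂)
    stepR : ∀ {p} → Post (FsimR X) p → FsimR X p

  FsimLF : Pred (S₁ × S₂) 0ℓ → Pred (S₁ × S₂) 0ℓ
  FsimLF X (s₁ , s₂) = FsimR X (s₁ , s₂) ⊎ (¬ F₁ s₁ × Post X (s₁ , s₂))

  FsimL : Pred (S₁ × S₂) (lsuc 0ℓ)
  FsimL = ν FsimLF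

  fsim-rdelay : Pred (S₁ × S₂) (lsuc 0ℓ)
  fsim-rdelay = FsimW FsimL

{-# OPTIONS --safe #-}
-- Language inclusion is closed under fsim^W, so it suffices to treat pairs in
-- fsim^L.  Given a post-fixed point Q of A₁'s language operator and one, R, of
-- fsim^L's operator, the words τ read from s₂ by some fsim^W(R)-related s₁ with
-- (s₁ , τ) in the least fixed point over Q form a post-fixed point of A₂'s
-- language operator.  From an R-pair, either s₁ ∉ F₁, so A₁ takes a
-- non-accepting step, which can happen only finitely often before A₁ accepts;
-- or the pair is in fsim^R, whose least fixed point drives A₂ into F₂ within
-- finitely many steps.
module Submission where

open import Defs
open import Level using () renaming (suc to lsuc; zero to 0ℓ)
open import Data.Product using (_,_; Σ-syntax; ∃-syntax; _×_)
open import Data.Sum using (inj₁; inj₂)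
open import Data.Empty using (⊥-elim)
open import Relation.Unary using (Pred; _⊆_)

module LangProperties {E : Set} (A : Buchi E) where
  open Buchi A

  LangF-mono : {P P′ : Pred (State × Word E) 0ℓ} → P ⊆ P′ → LangF A P ⊆ LangF A P′
  LangF-mono P⊆P′ (next st x)   = next st (LangF-mono P⊆P′ x)
  LangF-mono P⊆P′ (acc a st p)  = acc a st (P⊆P′ p)

  LangF⊆Lang : {Q : Pred (State × Word E) 0ℓ} → Q ⊆ LangF A Q → LangF A Q ⊆ Lang A
  LangF⊆Lang {Q} Q⊆FQ x = LangF A Q , LangF-mono Q⊆FQ , x

  LangF-uncons : {Q : Pred (State × Word E) 0ℓ} → Q ⊆ LangF A Q →
                 ∀ {s τ} → LangF A Q (s , τ) →
                 ∃[ s′ ] (Step s (hd τ) s′ × LangF A Q (s′ , tl τ))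
  LangF-uncons Q⊆FQ (next st x)  = _ , st , x
  LangF-uncons Q⊆FQ (acc a st q) = _ , st , Q⊆FQ q

  Lang-uncons : ∀ {s τ} → Lang A (s , τ) → ∃[ s′ ] (Step s (hd τ) s′ × Lang A (s′ , tl τ))
  Lang-uncons (Q , Q⊆FQ , q) with LangF-uncons Q⊆FQ (Q⊆FQ q)
  ... | s′ , st , x = s′ , st , LangF⊆Lang Q⊆FQ x

  Lang-cons : ∀ {s s′ τ} → Step s (hd τ) s′ → Lang A (s′ , tl τ) → Lang A (s , τ)
  Lang-cons st (Q , Q⊆FQ , q) = LangF A Q , LangF-mono Q⊆FQ , next st (Q⊆FQ q)

module SimProperties {E : Set} (A₁ A₂ : Buchi E) where
  open Buchi A₁ using () renaming (State to S₁)
  open Buchi A₂ using () renaming (State to S₂)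
  open Sim A₁ A₂
  open LangProperties

  LangIncl : Pred (S₁ × S₂) (lsuc 0ℓ)
  LangIncl (s₁ , s₂) = Lang⟨ A₁ ⟩ s₁ ⊆ Lang⟨ A₂ ⟩ s₂

  FsimW-LangIncl : ∀ {ℓ} {X : Pred (S₁ × S₂) ℓ} → X ⊆ LangIncl → FsimW X ⊆ LangIncl
  FsimW-LangIncl X⊆I (baseW x) l = X⊆I x l
  FsimW-LangIncl X⊆I (stepW post) {τ} l with Lang-uncons A₁ l
  ... | s₁′ , st₁ , l′ with post (hd τ) s₁′ st₁
  ... | s₂′ , st₂ , w = Lang-cons A₂ st₂ (FsimW-LangIncl X⊆I w l′)

  module Matching (Q : Pred (S₁ × Word E) 0ℓ) (Q⊆FQ : Q ⊆ LangF A₁ Q)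
                  (R : Pred (S₁ × S₂) 0ℓ) (R⊆FR : R ⊆ FsimLF R) where

    Matched : Pred (S₂ × Word E) 0ℓ
    Matched (s₂ , τ) = Σ[ s₁ ∈ S₁ ] (LangF A₁ Q (s₁ , τ) × FsimW R (s₁ , s₂))

    FsimR-match : ∀ {s₁ s₂ τ} → FsimR R (s₁ , s₂) → LangF A₁ Q (s₁ , τ) →
                  LangF A₂ Matched (s₂ , τ)
    FsimR-match {τ = τ} (accR f₂ post) l with LangF-uncons A₁ Q⊆FQ l
    ... | s₁′ , st₁ , l′ with post (hd τ) s₁′ st₁
    ... | s₂′ , st₂ , w = acc f₂ st₂ (s₁′ , l′ , w)
    FsimR-match {τ = τ} (stepR post) l with LangF-uncons A₁ Q⊆FQ l
    ... | s₁′ , st₁ , l′ with post (hd τ) s₁′ st₁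
    ... | s₂′ , st₂ , r = next st₂ (FsimR-match r l′)

    R-match : ∀ {s₁ s₂ τ} → R (s₁ , s₂) → LangF A₁ Q (s₁ , τ) → LangF A₂ Matched (s₂ , τ)
    R-match r l with R⊆FR r
    ... | inj₁ fr = FsimR-match fr l
    R-match r (acc f₁ _ _) | inj₂ (f₁∉F₁ , _) = ⊥-elim (f₁∉F₁ f₁)
    R-match {τ = τ} r (next {s' = s₁′} st₁ l′) | inj₂ (_ , post) with post (hd τ) s₁′ st₁
    ... | s₂′ , st₂ , r′ = next st₂ (R-match r′ l′)

    FsimW-match : ∀ {s₁ s₂ τ} → FsimW R (s₁ , s₂) → LangF A₁ Q (s₁ , τ) →
                  LangF A₂ Matched (s₂ , τ)
    FsimW-match (baseW r) l = R-match r l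
    FsimW-match {τ = τ} (stepW post) l with LangF-uncons A₁ Q⊆FQ l
    ... | s₁′ , st₁ , l′ with post (hd τ) s₁′ st₁
    ... | s₂′ , st₂ , w = next st₂ (FsimW-match w l′)

    Matched⊆LangF : Matched ⊆ LangF A₂ Matched
    Matched⊆LangF (_ , l , w) = FsimW-match w l

  FsimL⊆LangIncl : FsimL ⊆ LangIncl
  FsimL⊆LangIncl {s₁ , _} (R , R⊆FR , r) (Q , Q⊆FQ , q) =
    Matched , Matched⊆LangF , (s₁ , Q⊆FQ q , baseW r)
    where open Matching Q Q⊆FQ R R⊆FR

theorem5p8 : {E : Set} (A₁ A₂ : Buchi E)
    (s₁ : Buchi.State A₁) (s₂ : Buchi.State A₂) →
    Sim.fsim-rdelay A₁ A₂ (s₁ , s₂) →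
    Lang⟨ A₁ ⟩ s₁ ⊆ Lang⟨ A₂ ⟩ s₂
theorem5p8 A₁ A₂ s₁ s₂ = FsimW-LangIncl FsimL⊆LangIncl
  where open SimProperties A₁ A₂
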